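{- Let $g$ and $k$ be positive integers, and let $A \in \mathcal A_k$. Then the number of numerical semigroups with genus $g$ and type $(A; k)$ is at most $F_{g - |(A + A)\cap[0, k]| + |A| - k - 1}$, with equality if $3k \leq g + |A| + |(A + A)\cap[0, k]| -2$, which holds in particular if $3k \leq g$.
   Context: A numerical semigroup is a subset $\Lambda\subset\mathbb{N}_0$ closed under addition, containing $0$, with finite complement in $\mathbb{N}_0$; its multiplicity $m$ is its smallest nonzero element, its Frobenius number $f$ is the largest element of $\mathbb{N}_0\setminus\Lambda$, and its genus is $|\mathbb{N}_0\setminus\Lambda|$. For integers $a\le b$, $[a,b]=\{a,\dots,b\}$. For $A\subset\mathbb{Z}$, $b\in\mathbb{Z}$: $A+A=\{a_1+a_2:a_1,a_2\in A\}$, $b+A=\{a+b:a\in A\}$. For a positive integer $k$, $\mathcal A_k=\{A\subset[0,k-1]: 0\in A,\ k\notin A+A\}$. A numerical semigroup $\Lambda$ with multiplicity $m$ and Frobenius number $f$ with $2m<f<3m$ has type $(A;k)$ (with $k<m$ a positive integer, $A\in\mathcal A_k$) if $f=2m+k$ and $\Lambda\cap[m,m+k]=A+m$. $F_n$ are the Fibonacci numbers, $F_1=F_2=1$, $F_{n+2}=F_{n+1}+F_n$, with the convention $F_n=0$ for all $n\le 0$. -}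

module Defs where

open import Data.Bool using (Bool; true; false; _∧_; _∨_; if_then_else_)
open import Data.Nat using (ℕ; zero; suc; _+_; _*_; _∸_; _≤_; _<_)
open import Data.Integer as ℤ using (ℤ; +_; -[1+_])
open import Data.Fin.Subset using (Subset)
open import Data.Vec using (Vec; []; _∷_)
open import Data.List using (List; length)
open import Data.List.Relation.Unary.All using (All)
open import Data.List.Relation.Unary.Any using (Any)
open import Data.List.Relation.Unary.Unique.Propositional using (Unique)
open import Data.List.Relation.Unary.AllPairs using (AllPairs)
open import Data.List.Membership.Propositional using (_∈_)
open import Data.Product using (Σ; _×_; ∃-syntax)
open import Relation.Binary.PropositionalEquality using (_≡_; _≢_)
open import Relation.Nullary using (¬_)
open import Function.Bundles using (_⇔_)

-- Fibonacci numbers, F₀ = 0, F₁ = F₂ = 1, extended by F_n = 0 for n ≤ 0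

fib : ℕ → ℕ
fib zero = 0
fib (suc zero) = 1
fib (suc (suc n)) = fib (suc n) + fib n

fibℤ : ℤ → ℕ
fibℤ (+ n) = fib n
fibℤ -[1+ n ] = 0

SubsetNat : Set
SubsetNat = ℕ → Bool

_≈ₛ_ : SubsetNat → SubsetNat → Set
S ≈ₛ T = ∀ n → S n ≡ T n

IsNumericalSemigroup : SubsetNat → Set
IsNumericalSemigroup S =
  (S 0 ≡ true) ×
  (∀ a b → S a ≡ true → S b ≡ true → S (a + b) ≡ true) ×
  (∃[ N ] ∀ n → N ≤ n → S n ≡ true)

HasGenus : SubsetNat → ℕ → Set
HasGenus S g = ∃[ gaps ] (Unique gaps × length gaps ≡ g ×
                          (∀ n → (n ∈ gaps) ⇔ (S n ≡ false)))

IsMultiplicity : SubsetNat → ℕ → Set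
IsMultiplicity S m = (0 < m) × (S m ≡ true) × (∀ i → 0 < i → i < m → S i ≡ false)

IsFrobenius : SubsetNat → ℕ → Set
IsFrobenius S f = (S f ≡ false) × (∀ n → f < n → S n ≡ true)

-- Subsets A ⊆ [0,k-1], represented as Subset k (= Vec Bool k).

-- membership of a natural number in A (false for numbers ≥ k)
memb : ∀ {k} → Subset k → ℕ → Bool
memb [] n = false
memb (b ∷ v) zero = b
memb (b ∷ v) (suc n) = memb v n

card : ∀ {k} → Subset k → ℕ
card [] = 0
card (true ∷ v) = suc (card v)
card (false ∷ v) = card v

anyUpTo : ℕ → (ℕ → Bool) → Bool
anyUpTo zero p = p 0
anyUpTo (suc n) p = anyUpTo n p ∨ p (suc n)

countUpTo : ℕ → (ℕ → Bool) → ℕ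
countUpTo zero p = if p 0 then 1 else 0
countUpTo (suc n) p = countUpTo n p + (if p (suc n) then 1 else 0)

inSumset : ∀ {k} → Subset k → ℕ → Bool
inSumset A n = anyUpTo n (λ i → memb A i ∧ memb A (n ∸ i))

sumsetCount : ∀ {k} → Subset k → ℕ
sumsetCount {k} A = countUpTo k (inSumset A)

In𝒜 : (k : ℕ) → Subset k → Set
In𝒜 k A = (memb A 0 ≡ true) ×
          (∀ i j → memb A i ≡ true → memb A j ≡ true → i + j ≢ k)

HasType : SubsetNat → (k : ℕ) → Subset k → Set
HasType S k A = ∃[ m ] ∃[ f ]
  (IsMultiplicity S m × IsFrobenius S f ×
   (2 * m < f) × (f < 3 * m) × (k < m) × (f ≡ 2 * m + k) ×
   (∀ i → i ≤ k → S (m + i) ≡ memb A i))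

-- Counting: "the number of S with P S is at most n / exactly n",
-- where subsets are identified up to extensional equality.

Distinct : SubsetNat → SubsetNat → Set
Distinct S T = ¬ (S ≈ₛ T)

AtMost : (SubsetNat → Set) → ℕ → Set
AtMost P n = ∀ (L : List SubsetNat) → All P L → AllPairs Distinct L → length L ≤ n

Exactly : (SubsetNat → Set) → ℕ → Set
Exactly P n = Σ (List SubsetNat) λ L →
  All P L × AllPairs Distinct L × (∀ S → P S → Any (S ≈ₛ_) L) × (length L ≡ n)

NSGgenusType : ℕ → (k : ℕ) → Subset k → SubsetNat → Set
NSGgenusType g k A S = IsNumericalSemigroup S × HasGenus S g × HasType S k A

-- A numerical semigroup of type (A;k) with multiplicity m = 1 + r + k is determined by its
-- window t = Λ ∩ [m + k + 1, 2m + k − 1], which may be any subset of these r + k positions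
-- subject to two conditions: Λ is closed under addition exactly when t contains
-- 2m + ((A + A) ∩ [0, k − 1]), a set of s elements, and Λ has genus g exactly when
-- |t| = 2m + k − g − |A|. With u = k − s and v = g − s + |A| − k − 1 there are therefore
-- (u + r) C (2(u + r) + 1 − v) of them, and genus g forces r < g. Summing over r gives part of
-- the shallow diagonal ∑ₙ n C (2n + 1 − v) = F_v of Pascal's triangle; the missing terms, those
-- with n < u, vanish when 3k + 2 ≤ g + |A| + s.

module Submission where

open import Defs
open import Data.Nat using (ℕ; _+_; _*_; _≤_; _<_)
open import Data.Fin.Subset using (Subset)
open import Data.Product using (_×_; _,_)

open import Data.Bool using (Bool; true; false; _∨_; _∧_; if_then_else_)
import Data.Bool as Bool
open import Data.Bool.Properties using (∨-identityʳ; ∨-zeroʳ)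
open import Data.Empty using (⊥; ⊥-elim)
open import Data.List using (List; []; _∷_; [_]; length; map; concat; applyUpTo)
import Data.List as List
open import Data.List.Membership.Propositional using (_∈_)
open import Data.List.Membership.Propositional.Properties using (∈-map⁻; ∈-map⁺; ∈-++⁻; ∈-++⁺ˡ; ∈-++⁺ʳ)
open import Data.List.Properties using (length-map; length-++; length-removeAt′)
open import Data.List.Relation.Unary.All using (All; []; _∷_)
import Data.List.Relation.Unary.All as All
import Data.List.Relation.Unary.All.Properties as All
open import Data.List.Relation.Unary.AllPairs using (AllPairs; []; _∷_)
import Data.List.Relation.Unary.AllPairs as AllPairs
import Data.List.Relation.Unary.AllPairs.Properties as AllPairs
open import Data.List.Relation.Unary.Any using (Any; here; there; _─_)
import Data.List.Relation.Unary.Any as Any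
import Data.List.Relation.Unary.Any.Properties as Any
open import Data.List.Relation.Unary.Unique.Propositional using (Unique)
import Data.List.Relation.Unary.Unique.Propositional.Properties as Unique
open import Data.Nat using (zero; suc; _∸_; _≤ᵇ_; z≤n; s≤s; z<s; s<s; _≤?_; _<?_)
open import Data.Nat.Combinatorics using (_C_; k>n⇒nCk≡0; nCk+nC[k+1]≡[n+1]C[k+1])
open import Data.Nat.ListAction using (sum)
open import Data.Nat.Properties
open import Data.Nat.Tactic.RingSolver using (solve-∀)
open import Data.Product using (∃-syntax; proj₁; proj₂)
open import Data.Sum using (inj₁; inj₂)
open import Data.Vec using (Vec; []; _∷_; _++_; replicate)
open import Data.Vec.Properties using (∷-injectiveʳ)
open import Data.Vec.Relation.Binary.Pointwise.Inductive using (Pointwise; []; _∷_)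
open import Function.Bundles using (_⇔_; mk⇔; Equivalence)
open import Relation.Binary.Definitions using (tri<; tri≈; tri>)
open import Relation.Binary.PropositionalEquality
  using (_≡_; _≢_; refl; sym; trans; cong; cong₂; subst; subst₂; module ≡-Reasoning)
open import Relation.Nullary using (¬_; yes; no)
open import Relation.Nullary.Decidable using (dec-true; dec-false)
open import Algebra.Properties.CommutativeSemigroup +-commutativeSemigroup using (interchange)

private variable
  m n : ℕ

-- Finite sets as boolean vectors

true≢false : true ≢ false
true≢false ()

memb-++ˡ : (u : Vec Bool m) (v : Vec Bool n) {i : ℕ} → i < m → memb (u ++ v) i ≡ memb u i
memb-++ˡ (b ∷ u) v {zero} _ = refl
memb-++ˡ (b ∷ u) v {suc i} (s<s i<m) = memb-++ˡ u v i<m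

memb-++ʳ : (u : Vec Bool m) (v : Vec Bool n) (i : ℕ) → memb (u ++ v) (m + i) ≡ memb v i
memb-++ʳ [] v i = refl
memb-++ʳ (b ∷ u) v i = memb-++ʳ u v i

memb-replicate-false : ∀ n i → memb (replicate n false) i ≡ false
memb-replicate-false zero i = refl
memb-replicate-false (suc n) zero = refl
memb-replicate-false (suc n) (suc i) = memb-replicate-false n i

memb-≥ : (v : Vec Bool n) {i : ℕ} → n ≤ i → memb v i ≡ false
memb-≥ [] _ = refl
memb-≥ (b ∷ v) (s≤s n≤i) = memb-≥ v n≤i

memb⇒< : (v : Vec Bool n) {i : ℕ} → memb v i ≡ true → i < n
memb⇒< (b ∷ v) {zero} _ = z<s
memb⇒< (b ∷ v) {suc i} i∈ = s<s (memb⇒< v i∈)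

memb⇒card>0 : (v : Vec Bool n) {i : ℕ} → memb v i ≡ true → 0 < card v
memb⇒card>0 (true ∷ v) _ = z<s
memb⇒card>0 (false ∷ v) {suc i} i∈ = memb⇒card>0 v i∈

memb-injective : (u v : Vec Bool n) → (∀ {i} → i < n → memb u i ≡ memb v i) → u ≡ v
memb-injective [] [] _ = refl
memb-injective (b ∷ u) (c ∷ v) eq = cong₂ _∷_ (eq z<s) (memb-injective u v (λ i<n → eq (s<s i<n)))

card-++ : (u : Vec Bool m) (v : Vec Bool n) → card (u ++ v) ≡ card u + card v
card-++ [] v = refl
card-++ (true ∷ u) v = cong suc (card-++ u v)
card-++ (false ∷ u) v = card-++ u v

card-replicate-false : ∀ n → card (replicate n false) ≡ 0
card-replicate-false zero = refl
card-replicate-false (suc n) = card-replicate-false n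

card≤length : (v : Vec Bool n) → card v ≤ n
card≤length [] = z≤n
card≤length (true ∷ v) = s≤s (card≤length v)
card≤length (false ∷ v) = m≤n⇒m≤1+n (card≤length v)

slice : (ℕ → Bool) → ℕ → (n : ℕ) → Vec Bool n
slice p lo zero = []
slice p lo (suc n) = p lo ∷ slice p (suc lo) n

memb-slice : ∀ p lo {n i} → i < n → memb (slice p lo n) i ≡ p (lo + i)
memb-slice p lo {i = zero} z<s = cong p (sym (+-identityʳ lo))
memb-slice p lo {i = suc i} (s<s i<n) = trans (memb-slice p (suc lo) i<n) (cong p (sym (+-suc lo i)))

slice-+ : ∀ p lo m n → slice p lo (m + n) ≡ slice p lo m ++ slice p (lo + m) n
slice-+ p lo zero n = cong (λ l → slice p l n) (sym (+-identityʳ lo))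
slice-+ p lo (suc m) n = cong (p lo ∷_)
  (trans (slice-+ p (suc lo) m n) (cong (λ l → slice p (suc lo) m ++ slice p l n) (sym (+-suc lo m))))

countUpTo≡card-slice : ∀ n p → countUpTo n p ≡ card (slice p 0 (suc n))
countUpTo≡card-slice zero p with p 0
... | true = refl
... | false = refl
countUpTo≡card-slice (suc n) p = begin
  countUpTo n p + (if p (suc n) then 1 else 0)    ≡⟨ cong₂ _+_ (countUpTo≡card-slice n p) (lastBit (p (suc n))) ⟩
  card (slice p 0 (suc n)) + card (slice p (suc n) 1) ≡⟨ card-++ (slice p 0 (suc n)) (slice p (suc n) 1) ⟨
  card (slice p 0 (suc n) ++ slice p (suc n) 1)   ≡⟨ cong card (slice-+ p 0 (suc n) 1) ⟨
  card (slice p 0 (suc n + 1))                    ≡⟨ cong (λ l → card (slice p 0 l)) (+-comm (suc n) 1) ⟩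
  card (slice p 0 (suc (suc n)))                  ∎
  where
  open ≡-Reasoning
  lastBit : ∀ b → (if b then 1 else 0) ≡ card (b ∷ [])
  lastBit true = refl
  lastBit false = refl

_⊆_ : Vec Bool n → Vec Bool n → Set
_⊆_ = Pointwise Bool._≤_

⊆-memb : {u v : Vec Bool n} → u ⊆ v → ∀ i → memb u i ≡ true → memb v i ≡ true
⊆-memb (Bool.b≤b ∷ u⊆v) zero eq = eq
⊆-memb (Bool.f≤t ∷ u⊆v) zero eq = refl
⊆-memb (_ ∷ u⊆v) (suc i) eq = ⊆-memb u⊆v i eq

memb-⊆ : (u v : Vec Bool n) → (∀ i → memb u i ≡ true → memb v i ≡ true) → u ⊆ v
memb-⊆ [] [] _ = []
memb-⊆ (b ∷ u) (c ∷ v) h = head (h 0) ∷ memb-⊆ u v (λ i → h (suc i))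
  where
  head : ∀ {b c} → (b ≡ true → c ≡ true) → b Bool.≤ c
  head {false} {false} _ = Bool.b≤b
  head {false} {true} _ = Bool.f≤t
  head {true} h with h refl
  ... | refl = Bool.b≤b

anyUpTo-sound : ∀ n p → anyUpTo n p ≡ true → ∃[ i ] (i ≤ n × p i ≡ true)
anyUpTo-sound zero p eq = 0 , z≤n , eq
anyUpTo-sound (suc n) p eq with anyUpTo n p in eq′
... | true = let (i , i≤n , pi) = anyUpTo-sound n p eq′ in i , m≤n⇒m≤1+n i≤n , pi
... | false = suc n , ≤-refl , eq

anyUpTo-complete : ∀ n p {i} → i ≤ n → p i ≡ true → anyUpTo n p ≡ true
anyUpTo-complete zero p z≤n pi = pi
anyUpTo-complete (suc n) p {i} i≤1+n pi with m≤n⇒m<n∨m≡n i≤1+n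
... | inj₁ i<1+n = cong (_∨ p (suc n)) (anyUpTo-complete n p (≤-pred i<1+n) pi)
... | inj₂ refl = trans (cong (anyUpTo n p ∨_) pi) (∨-zeroʳ _)

module _ {k : ℕ} (A : Subset k) where

  inSumset-sound : ∀ {c} → inSumset A c ≡ true → ∃[ i ] (i ≤ c × memb A i ≡ true × memb A (c ∸ i) ≡ true)
  inSumset-sound {c} c∈ with anyUpTo-sound c (λ i → memb A i ∧ memb A (c ∸ i)) c∈
  ... | i , i≤c , both with memb A i in i∈ | memb A (c ∸ i) in c-i∈
  ...   | true | true = i , i≤c , i∈ , c-i∈

  inSumset-complete : ∀ {i j} → memb A i ≡ true → memb A j ≡ true → inSumset A (i + j) ≡ true
  inSumset-complete {i} {j} i∈ j∈ = anyUpTo-complete (i + j) _ (m≤m+n i j) both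
    where
    both : (memb A i ∧ memb A (i + j ∸ i)) ≡ true
    both rewrite m+n∸m≡n i j | i∈ | j∈ = refl

-- n C[ y - v ] is n C (y − v) for v ≤ y, and 0 for y < v.
_C[_-_] : ℕ → ℕ → ℕ → ℕ
n C[ y - zero ] = n C y
n C[ zero - suc v ] = 0
n C[ suc y - suc v ] = n C[ y - v ]

C[-]-shift : ∀ n c y v → n C[ (c + y) - (c + v) ] ≡ n C[ y - v ]
C[-]-shift n zero y v = refl
C[-]-shift n (suc c) y v = C[-]-shift n c y v

C[-]-< : ∀ n {y v} → y < v → n C[ y - v ] ≡ 0
C[-]-< n {zero} {suc v} _ = refl
C[-]-< n {suc y} {suc v} (s<s y<v) = C[-]-< n y<v

C[-]-> : ∀ n {y} v → n + v < y → n C[ y - v ] ≡ 0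
C[-]-> n {y} zero n+0<y = k>n⇒nCk≡0 (subst (_< y) (+-identityʳ n) n+0<y)
C[-]-> n {suc y} (suc v) n+v<y = C[-]-> n v (≤-pred (subst (_< suc y) (+-suc n v) n+v<y))

C[0-]-suc : ∀ n v → suc n C[ 0 - v ] ≡ n C[ 0 - v ]
C[0-]-suc n zero = refl
C[0-]-suc n (suc v) = refl

C[-]-pascal : ∀ n y v → suc n C[ suc y - v ] ≡ n C[ y - v ] + n C[ suc y - v ]
C[-]-pascal n y zero = sym (nCk+nC[k+1]≡[n+1]C[k+1] n y)
C[-]-pascal n zero (suc v) = C[0-]-suc n v
C[-]-pascal n (suc y) (suc v) = C[-]-pascal n y v

supersetsOfSize : Vec Bool n → ℕ → List (Vec Bool n)
supersetsOfSize [] zero = [ [] ]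
supersetsOfSize [] (suc p) = []
supersetsOfSize (true ∷ f) zero = []
supersetsOfSize (true ∷ f) (suc p) = map (true ∷_) (supersetsOfSize f p)
supersetsOfSize (false ∷ f) zero = map (false ∷_) (supersetsOfSize f zero)
supersetsOfSize (false ∷ f) (suc p) =
  map (false ∷_) (supersetsOfSize f (suc p)) List.++ map (true ∷_) (supersetsOfSize f p)

∈-supersetsOfSize⁻ : (f : Vec Bool n) {p : ℕ} {t : Vec Bool n} →
  t ∈ supersetsOfSize f p → f ⊆ t × card t ≡ p
∈-supersetsOfSize⁻ [] {zero} (here refl) = [] , refl
∈-supersetsOfSize⁻ (true ∷ f) {suc p} t∈ with ∈-map⁻ (true ∷_) t∈
... | t , t∈′ , refl with ∈-supersetsOfSize⁻ f t∈′
...   | f⊆t , eq = Bool.b≤b ∷ f⊆t , cong suc eq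
∈-supersetsOfSize⁻ (false ∷ f) {zero} t∈ with ∈-map⁻ (false ∷_) t∈
... | t , t∈′ , refl with ∈-supersetsOfSize⁻ f t∈′
...   | f⊆t , eq = Bool.b≤b ∷ f⊆t , eq
∈-supersetsOfSize⁻ (false ∷ f) {suc p} t∈ with ∈-++⁻ (map (false ∷_) (supersetsOfSize f (suc p))) t∈
... | inj₁ t∈₁ with ∈-map⁻ (false ∷_) t∈₁
...   | t , t∈′ , refl with ∈-supersetsOfSize⁻ f t∈′
...     | f⊆t , eq = Bool.b≤b ∷ f⊆t , eq
∈-supersetsOfSize⁻ (false ∷ f) {suc p} t∈ | inj₂ t∈₂ with ∈-map⁻ (true ∷_) t∈₂
...   | t , t∈′ , refl with ∈-supersetsOfSize⁻ f t∈′
...     | f⊆t , eq = Bool.f≤t ∷ f⊆t , cong suc eq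

∈-supersetsOfSize⁺ : {f t : Vec Bool n} → f ⊆ t → t ∈ supersetsOfSize f (card t)
∈-supersetsOfSize⁺ [] = here refl
∈-supersetsOfSize⁺ {f = true ∷ f} (Bool.b≤b ∷ f⊆t) = ∈-map⁺ (true ∷_) (∈-supersetsOfSize⁺ f⊆t)
∈-supersetsOfSize⁺ {f = false ∷ f} {t = false ∷ t} (Bool.b≤b ∷ f⊆t) with card t | ∈-supersetsOfSize⁺ f⊆t
... | zero | t∈ = ∈-map⁺ (false ∷_) t∈
... | suc p | t∈ = ∈-++⁺ˡ (∈-map⁺ (false ∷_) t∈)
∈-supersetsOfSize⁺ {f = false ∷ f} (Bool.f≤t ∷ f⊆t) =
  ∈-++⁺ʳ (map (false ∷_) (supersetsOfSize f _)) (∈-map⁺ (true ∷_) (∈-supersetsOfSize⁺ f⊆t))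

supersetsOfSize-unique : (f : Vec Bool n) (p : ℕ) → Unique (supersetsOfSize f p)
supersetsOfSize-unique [] zero = [] ∷ []
supersetsOfSize-unique [] (suc p) = []
supersetsOfSize-unique (true ∷ f) zero = []
supersetsOfSize-unique (true ∷ f) (suc p) = Unique.map⁺ ∷-injectiveʳ (supersetsOfSize-unique f p)
supersetsOfSize-unique (false ∷ f) zero = Unique.map⁺ ∷-injectiveʳ (supersetsOfSize-unique f zero)
supersetsOfSize-unique (false ∷ f) (suc p) =
  Unique.++⁺ (Unique.map⁺ ∷-injectiveʳ (supersetsOfSize-unique f (suc p)))
             (Unique.map⁺ ∷-injectiveʳ (supersetsOfSize-unique f p))
             disjoint
  where
  disjoint : ∀ {t} → t ∈ map (false ∷_) (supersetsOfSize f (suc p)) × t ∈ map (true ∷_) (supersetsOfSize f p) →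
             ⊥
  disjoint (t∈₁ , t∈₂) with ∈-map⁻ (false ∷_) t∈₁ | ∈-map⁻ (true ∷_) t∈₂
  ... | _ , _ , refl | _ , _ , ()

length-supersetsOfSize : (f : Vec Bool n) (p : ℕ) → length (supersetsOfSize f p) ≡ (n ∸ card f) C[ p - card f ]
length-supersetsOfSize [] zero = refl
length-supersetsOfSize [] (suc p) = refl
length-supersetsOfSize (true ∷ f) zero = refl
length-supersetsOfSize (true ∷ f) (suc p) =
  trans (length-map (true ∷_) (supersetsOfSize f p)) (length-supersetsOfSize f p)
length-supersetsOfSize {suc n} (false ∷ f) zero = begin
  length (map (false ∷_) (supersetsOfSize f 0)) ≡⟨ length-map (false ∷_) (supersetsOfSize f 0) ⟩
  length (supersetsOfSize f 0)                  ≡⟨ length-supersetsOfSize f 0 ⟩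
  (n ∸ card f) C[ 0 - card f ]                  ≡⟨ C[0-]-suc (n ∸ card f) (card f) ⟨
  suc (n ∸ card f) C[ 0 - card f ]              ≡⟨ cong (_C[ 0 - card f ]) (+-∸-assoc 1 (card≤length f)) ⟨
  (suc n ∸ card f) C[ 0 - card f ]              ∎
  where open ≡-Reasoning
length-supersetsOfSize {suc n} (false ∷ f) (suc p) = begin
  length (map (false ∷_) (supersetsOfSize f (suc p)) List.++ map (true ∷_) (supersetsOfSize f p))
    ≡⟨ length-++ (map (false ∷_) (supersetsOfSize f (suc p))) ⟩
  length (map (false ∷_) (supersetsOfSize f (suc p))) + length (map (true ∷_) (supersetsOfSize f p))
    ≡⟨ cong₂ _+_ (trans (length-map _ (supersetsOfSize f (suc p))) (length-supersetsOfSize f (suc p)))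
                 (trans (length-map _ (supersetsOfSize f p)) (length-supersetsOfSize f p)) ⟩
  (n ∸ card f) C[ suc p - card f ] + (n ∸ card f) C[ p - card f ]
    ≡⟨ +-comm ((n ∸ card f) C[ suc p - card f ]) _ ⟩
  (n ∸ card f) C[ p - card f ] + (n ∸ card f) C[ suc p - card f ]
    ≡⟨ C[-]-pascal (n ∸ card f) p (card f) ⟨
  suc (n ∸ card f) C[ suc p - card f ]
    ≡⟨ cong (_C[ suc p - card f ]) (+-∸-assoc 1 (card≤length f)) ⟨
  (suc n ∸ card f) C[ suc p - card f ] ∎
  where open ≡-Reasoning

module _ {A B : Set} {D : A → A → Set} {R : A → B → Set}
         (separated : ∀ {x y b} → R x b → R y b → ¬ D x y) where

  private
    ─-keeps : ∀ {x y} {bs : List B} (p : Any (R x) bs) → D x y → Any (R y) bs → Any (R y) (bs ─ p)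
    ─-keeps (here a) d (here b) = ⊥-elim (separated a b d)
    ─-keeps (here a) d (there q) = q
    ─-keeps (there p) d (here b) = here b
    ─-keeps (there p) d (there q) = there (─-keeps p d q)

  pigeonhole : (as : List A) (bs : List B) → AllPairs D as → All (λ a → Any (R a) bs) as →
               length as ≤ length bs
  pigeonhole [] bs _ _ = z≤n
  pigeonhole (a ∷ as) bs (Da ∷ Das) (p ∷ ps) =
    subst (suc (length as) ≤_) (sym (length-removeAt′ bs (Any.index p)))
      (s≤s (pigeonhole as (bs ─ p) Das (All.zipWith (λ (d , q) → ─-keeps p d q) (Da , ps))))

-- Sums along a diagonal of Pascal's triangle

∑ : ℕ → (ℕ → ℕ) → ℕ
∑ N f = sum (applyUpTo f N)

infix 7 ∑
syntax ∑ N (λ i → e) = ∑[ i < N ] e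

∑-cong : ∀ N {f g : ℕ → ℕ} → (∀ {i} → i < N → f i ≡ g i) → ∑ N f ≡ ∑ N g
∑-cong zero eq = refl
∑-cong (suc N) eq = cong₂ _+_ (eq z<s) (∑-cong N (λ i<N → eq (s<s i<N)))

∑-zero : ∀ N {f : ℕ → ℕ} → (∀ {i} → i < N → f i ≡ 0) → ∑ N f ≡ 0
∑-zero zero eq = refl
∑-zero (suc N) eq = cong₂ _+_ (eq z<s) (∑-zero N (λ i<N → eq (s<s i<N)))

∑-distrib-+ : ∀ N (f g : ℕ → ℕ) → ∑[ i < N ] (f i + g i) ≡ ∑ N f + ∑ N g
∑-distrib-+ zero f g = refl
∑-distrib-+ (suc N) f g = trans (cong (f 0 + g 0 +_) (∑-distrib-+ N (λ i → f (suc i)) (λ i → g (suc i))))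
                                (interchange (f 0) (g 0) _ _)

length-concat-applyUpTo : ∀ {X : Set} N (f : ℕ → List X) →
                          length (concat (applyUpTo f N)) ≡ ∑[ i < N ] length (f i)
length-concat-applyUpTo zero f = refl
length-concat-applyUpTo (suc N) f =
  trans (length-++ (f 0)) (cong (length (f 0) +_) (length-concat-applyUpTo N (λ i → f (suc i))))

∑-split : ∀ M N (f : ℕ → ℕ) → ∑ (M + N) f ≡ ∑ M f + ∑[ i < N ] f (M + i)
∑-split zero N f = refl
∑-split (suc M) N f = trans (cong (f 0 +_) (∑-split M N (λ i → f (suc i)))) (sym (+-assoc (f 0) _ _))

-- n C (2n + 1 − v) = n C (v − 1 − n): this is a sum along a shallow diagonal of Pascal's triangle.
∑-C[-]≡fib : ∀ v N → v ≤ N → ∑[ n < N ] n C[ suc (n + n) - v ] ≡ fib v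
∑-C[-]≡fib zero N _ = ∑-zero N (λ {n} _ → k>n⇒nCk≡0 (s≤s (m≤m+n n n)))
∑-C[-]≡fib (suc zero) (suc N) _ =
  cong suc (∑-zero N (λ {n} _ → k>n⇒nCk≡0 (subst (suc n <_) (sym (+-suc (suc n) n)) (s≤s (s≤s (m≤m+n n n))))))
∑-C[-]≡fib (suc (suc v)) (suc N) (s≤s v+1≤N) = begin
  ∑[ n < N ] suc n C[ suc n + suc n - suc v ]
    ≡⟨ ∑-cong N (λ {n} _ → cong (λ y → suc n C[ y - suc v ]) (+-suc (suc n) n)) ⟩
  ∑[ n < N ] suc n C[ suc (n + n) - v ]
    ≡⟨ ∑-cong N (λ {n} _ → C[-]-pascal n (n + n) v) ⟩
  ∑[ n < N ] (n C[ suc (n + n) - suc v ] + n C[ suc (n + n) - v ])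
    ≡⟨ ∑-distrib-+ N _ _ ⟩
  ∑[ n < N ] n C[ suc (n + n) - suc v ] + ∑[ n < N ] n C[ suc (n + n) - v ]
    ≡⟨ cong₂ _+_ (∑-C[-]≡fib (suc v) N v+1≤N) (∑-C[-]≡fib v N (≤-trans (n≤1+n v) v+1≤N)) ⟩
  fib (suc v) + fib v ∎
  where open ≡-Reasoning

-- Cofinite sets, genus and multiplicity

cofinite : Vec Bool n → SubsetNat
cofinite {n} v x = memb v x ∨ (n ≤ᵇ x)

cofinite-< : (v : Vec Bool n) {x : ℕ} → x < n → cofinite v x ≡ memb v x
cofinite-< {n} v {x} x<n = trans (cong (memb v x ∨_) (dec-false (n ≤? x) (<⇒≱ x<n))) (∨-identityʳ _)

cofinite-≥ : (v : Vec Bool n) {x : ℕ} → n ≤ x → cofinite v x ≡ true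
cofinite-≥ {n} v {x} n≤x = trans (cong (memb v x ∨_) (dec-true (n ≤? x) n≤x)) (∨-zeroʳ _)

falsePositions : Vec Bool n → List ℕ
falsePositions [] = []
falsePositions (true ∷ v) = map suc (falsePositions v)
falsePositions (false ∷ v) = 0 ∷ map suc (falsePositions v)

∈-falsePositions⁻ : (v : Vec Bool n) {x : ℕ} → x ∈ falsePositions v → x < n × memb v x ≡ false
∈-falsePositions⁻ (true ∷ v) x∈ with ∈-map⁻ suc x∈
... | x , x∈′ , refl with ∈-falsePositions⁻ v x∈′
...   | x<n , eq = s<s x<n , eq
∈-falsePositions⁻ (false ∷ v) (here refl) = z<s , refl
∈-falsePositions⁻ (false ∷ v) (there x∈) with ∈-map⁻ suc x∈
... | x , x∈′ , refl with ∈-falsePositions⁻ v x∈′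
...   | x<n , eq = s<s x<n , eq

∈-falsePositions⁺ : (v : Vec Bool n) {x : ℕ} → x < n → memb v x ≡ false → x ∈ falsePositions v
∈-falsePositions⁺ (true ∷ v) {suc x} (s<s x<n) eq = ∈-map⁺ suc (∈-falsePositions⁺ v x<n eq)
∈-falsePositions⁺ (false ∷ v) {zero} _ _ = here refl
∈-falsePositions⁺ (false ∷ v) {suc x} (s<s x<n) eq = there (∈-map⁺ suc (∈-falsePositions⁺ v x<n eq))

falsePositions-unique : (v : Vec Bool n) → Unique (falsePositions v)
falsePositions-unique [] = []
falsePositions-unique (true ∷ v) = Unique.map⁺ suc-injective (falsePositions-unique v)
falsePositions-unique (false ∷ v) =
  All.tabulate (λ x∈ 0≡x → let (_ , _ , x≡) = ∈-map⁻ suc x∈ in 0≢1+n (trans 0≡x x≡))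
  ∷ Unique.map⁺ suc-injective (falsePositions-unique v)

length-falsePositions : (v : Vec Bool n) → length (falsePositions v) + card v ≡ n
length-falsePositions [] = refl
length-falsePositions (true ∷ v) =
  trans (+-suc _ (card v))
        (cong suc (trans (cong (_+ card v) (length-map suc (falsePositions v))) (length-falsePositions v)))
length-falsePositions (false ∷ v) =
  cong suc (trans (cong (_+ card v) (length-map suc (falsePositions v))) (length-falsePositions v))

cofinite-hasGenus : (v : Vec Bool n) → HasGenus (cofinite v) (length (falsePositions v))
cofinite-hasGenus {n} v = falsePositions v , falsePositions-unique v , refl , λ x → mk⇔ (to x) (from x)
  where
  to : ∀ x → x ∈ falsePositions v → cofinite v x ≡ false
  to x x∈ = let (x<n , eq) = ∈-falsePositions⁻ v x∈ in trans (cofinite-< v x<n) eq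
  from : ∀ x → cofinite v x ≡ false → x ∈ falsePositions v
  from x eq with x <? n
  ... | yes x<n = ∈-falsePositions⁺ v x<n (trans (sym (cofinite-< v x<n)) eq)
  ... | no x≮n = ⊥-elim (true≢false (trans (sym (cofinite-≥ v (≮⇒≥ x≮n))) eq))

hasGenus-unique : ∀ {S g h} → HasGenus S g → HasGenus S h → g ≡ h
hasGenus-unique {S} (gaps , gaps! , refl , gaps⇔) (gaps′ , gaps′! , refl , gaps′⇔) =
  ≤-antisym (count gaps! gaps⇔ gaps′⇔) (count gaps′! gaps′⇔ gaps⇔)
  where
  count : ∀ {as bs} → Unique as → (∀ n → (n ∈ as) ⇔ (S n ≡ false)) →
          (∀ n → (n ∈ bs) ⇔ (S n ≡ false)) → length as ≤ length bs
  count {as} {bs} as! as⇔ bs⇔ = pigeonhole (λ { refl refl x≢x → x≢x refl }) as bs as!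
    (All.tabulate λ {x} x∈ → Equivalence.from (bs⇔ x) (Equivalence.to (as⇔ x) x∈))

hasGenus-resp : ∀ {S T g} → S ≈ₛ T → HasGenus S g → HasGenus T g
hasGenus-resp S≈T (gaps , gaps! , len , gaps⇔) =
  gaps , gaps! , len , λ x → mk⇔ (λ x∈ → trans (sym (S≈T x)) (Equivalence.to (gaps⇔ x) x∈))
                                 (λ eq → Equivalence.from (gaps⇔ x) (trans (S≈T x) eq))

hasGenus-cofinite⁺ : (v : Vec Bool n) {g : ℕ} → g + card v ≡ n → HasGenus (cofinite v) g
hasGenus-cofinite⁺ v {g} eq = subst (HasGenus (cofinite v))
  (+-cancelʳ-≡ (card v) _ _ (trans (length-falsePositions v) (sym eq))) (cofinite-hasGenus v)

hasGenus-cofinite⁻ : (v : Vec Bool n) {g : ℕ} → HasGenus (cofinite v) g → g + card v ≡ n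
hasGenus-cofinite⁻ v hasGenus =
  trans (cong (_+ card v) (hasGenus-unique hasGenus (cofinite-hasGenus v))) (length-falsePositions v)

cofinite-∷ : (b : Bool) (v : Vec Bool n) (x : ℕ) → cofinite (b ∷ v) (suc x) ≡ cofinite v x
cofinite-∷ {zero} b v x = refl
cofinite-∷ {suc n} b v x = refl

cofinite-++ʳ : (u : Vec Bool m) (v : Vec Bool n) (x : ℕ) → cofinite (u ++ v) (m + x) ≡ cofinite v x
cofinite-++ʳ [] v x = refl
cofinite-++ʳ (b ∷ u) v x = trans (cofinite-∷ b (u ++ v) _) (cofinite-++ʳ u v x)

cofinite-replicate-false : (v : Vec Bool n) {x : ℕ} → x < m → cofinite (replicate m false ++ v) x ≡ false
cofinite-replicate-false v {zero} z<s = refl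
cofinite-replicate-false {m = suc m} v {suc x} (s<s x<m) =
  trans (cofinite-∷ false (replicate m false ++ v) x) (cofinite-replicate-false v x<m)

cofinite-++-false∷ : (u : Vec Bool m) (v : Vec Bool n) {x : ℕ} → x ≤ m → cofinite (u ++ false ∷ v) x ≡ memb u x
cofinite-++-false∷ [] v z≤n = refl
cofinite-++-false∷ (b ∷ u) v {zero} _ = ∨-identityʳ b
cofinite-++-false∷ (b ∷ u) v {suc x} (s≤s x≤m) =
  trans (cofinite-∷ b (u ++ false ∷ v) x) (cofinite-++-false∷ u v x≤m)

isMultiplicity-unique : ∀ {S T m m′} → S ≈ₛ T → IsMultiplicity S m → IsMultiplicity T m′ → m ≡ m′
isMultiplicity-unique {S} {T} {m} {m′} S≈T (0<m , m∈S , S<m) (0<m′ , m′∈T , T<m′) with <-cmp m m′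
... | tri< m<m′ _ _ = ⊥-elim (true≢false (trans (sym m∈S) (trans (S≈T m) (T<m′ m 0<m m<m′))))
... | tri≈ _ m≡m′ _ = m≡m′
... | tri> _ _ m′<m = ⊥-elim (true≢false (trans (sym m′∈T) (trans (sym (S≈T m′)) (S<m m′ 0<m′ m′<m))))

-- Numerical semigroups of type (A;k)

IsClosed : SubsetNat → Set
IsClosed S = ∀ x y → S x ≡ true → S y ≡ true → S (x + y) ≡ true

module OfType {k : ℕ} (A : Subset k) where

  -- A subset of ℕ of type (A;k) with multiplicity m = 1 + m′ is determined
  -- by its window t = S ∩ [m + k + 1, 2m + k - 1], shifted down to start at 0.
  record Shape (S : SubsetNat) (m′ : ℕ) (t : Vec Bool m′) : Set where
    field
      zero∈ : S 0 ≡ true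
      gap∉ : ∀ {i} → i < m′ → S (suc i) ≡ false
      block≡ : ∀ {i} → i ≤ k → S (suc m′ + i) ≡ memb A i
      window≡ : ∀ {i} → i < m′ → S (suc (suc m′ + k + i)) ≡ memb t i
      frobenius∉ : S (suc m′ + suc m′ + k) ≡ false
      beyond∈ : ∀ {x} → suc m′ + suc m′ + k < x → S x ≡ true

  open Shape public

  data Position (m′ : ℕ) : ℕ → Set where
    origin : Position m′ 0
    gap : ∀ {i} → i < m′ → Position m′ (suc i)
    block : ∀ {i} → i ≤ k → Position m′ (suc m′ + i)
    window : ∀ {i} → i < m′ → Position m′ (suc (suc m′ + k + i))
    frobenius : Position m′ (suc m′ + suc m′ + k)
    beyond : ∀ {x} → suc m′ + suc m′ + k < x → Position m′ x

  position : ∀ m′ x → Position m′ x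
  position m′ zero = origin
  position m′ (suc x) with x <? m′
  ... | yes x<m′ = gap x<m′
  ... | no x≮m′ with m≤n⇒∃[o]m+o≡n (≮⇒≥ x≮m′)
  ...   | i , refl = pastGap i
    where
    pastBlock : ∀ j → Position m′ (suc (suc m′ + k + j))
    pastBlock j with j <? m′
    ... | yes j<m′ = window j<m′
    ... | no j≮m′ with m≤n⇒∃[o]m+o≡n (≮⇒≥ j≮m′)
    ...   | zero , refl = subst (Position m′) (frobenius-position m′ k) frobenius
      where
      frobenius-position : ∀ m′ k → suc m′ + suc m′ + k ≡ suc (suc m′ + k + (m′ + 0))
      frobenius-position = solve-∀
    ...   | suc l , refl = beyond (subst (suc m′ + suc m′ + k <_) (beyond-position m′ k l) (s≤s (m≤m+n _ l)))
      where
      beyond-position : ∀ m′ k l → suc (suc m′ + suc m′ + k + l) ≡ suc (suc m′ + k + (m′ + suc l))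
      beyond-position = solve-∀

    pastGap : ∀ i → Position m′ (suc (m′ + i))
    pastGap i with i ≤? k
    ... | yes i≤k = block i≤k
    ... | no i≰k with m≤n⇒∃[o]m+o≡n (≰⇒> i≰k)
    ...   | j , refl = subst (Position m′) (block-end m′ k j) (pastBlock j)
      where
      block-end : ∀ m′ k j → suc (suc m′ + k + j) ≡ suc (m′ + (suc k + j))
      block-end = solve-∀

  shape-≈ : ∀ {S T m′ t} → Shape S m′ t → Shape T m′ t → S ≈ₛ T
  shape-≈ {m′ = m′} S-shape T-shape x with position m′ x
  ... | origin = trans (zero∈ S-shape) (sym (zero∈ T-shape))
  ... | gap i<m′ = trans (gap∉ S-shape i<m′) (sym (gap∉ T-shape i<m′))
  ... | block i≤k = trans (block≡ S-shape i≤k) (sym (block≡ T-shape i≤k))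
  ... | window i<m′ = trans (window≡ S-shape i<m′) (sym (window≡ T-shape i<m′))
  ... | frobenius = trans (frobenius∉ S-shape) (sym (frobenius∉ T-shape))
  ... | beyond f<x = trans (beyond∈ S-shape f<x) (sym (beyond∈ T-shape f<x))

  shape-window-injective : ∀ {S T m′ t t′} → Shape S m′ t → Shape T m′ t′ → S ≈ₛ T → t ≡ t′
  shape-window-injective {t = t} {t′} S-shape T-shape S≈T =
    memb-injective t t′ (λ i<m′ → trans (sym (window≡ S-shape i<m′)) (trans (S≈T _) (window≡ T-shape i<m′)))

  prefix : (m′ : ℕ) → Vec Bool m′ → Vec Bool (suc (m′ + (k + suc (m′ + 1))))
  prefix m′ t = true ∷ replicate m′ false ++ A ++ false ∷ t ++ false ∷ []

  candidate : (m′ : ℕ) → Vec Bool m′ → SubsetNat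
  candidate m′ t = cofinite (prefix m′ t)

  candidate-shape : ∀ m′ t → Shape (candidate m′ t) m′ t
  candidate-shape m′ t = record
    { zero∈ = refl
    ; gap∉ = λ {i} i<m′ → trans (cofinite-∷ true afterOrigin i) (cofinite-replicate-false afterGap i<m′)
    ; block≡ = λ {i} i≤k → trans (cofinite-∷ true afterOrigin (m′ + i))
                             (trans (cofinite-++ʳ (replicate m′ false) afterGap i) (cofinite-++-false∷ A afterBlock i≤k))
    ; window≡ = λ {i} i<m′ → trans (cong (candidate m′ t) (window-position m′ k i))
                               (trans (past-block i) (cofinite-++-false∷ t [] (<⇒≤ i<m′)))
    ; frobenius∉ = trans (cong (candidate m′ t) (frobenius-position m′ k))
                     (trans (past-block m′) (trans (cofinite-++-false∷ t [] ≤-refl) (memb-≥ t ≤-refl)))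
    ; beyond∈ = λ {x} f<x → cofinite-≥ (prefix m′ t) {x} (subst (_≤ x) (prefix-length m′ k) f<x)
    }
    where
    afterBlock = t ++ false ∷ []
    afterGap = A ++ false ∷ afterBlock
    afterOrigin = replicate m′ false ++ afterGap
    window-position : ∀ m′ k i → suc (suc m′ + k + i) ≡ suc (m′ + (k + suc i))
    window-position = solve-∀
    frobenius-position : ∀ m′ k → suc m′ + suc m′ + k ≡ suc (m′ + (k + suc m′))
    frobenius-position = solve-∀
    prefix-length : ∀ m′ k → suc (suc m′ + suc m′ + k) ≡ suc (m′ + (k + suc (m′ + 1)))
    prefix-length = solve-∀
    past-block : ∀ i → candidate m′ t (suc (m′ + (k + suc i))) ≡ cofinite afterBlock i
    past-block i = trans (cofinite-∷ true afterOrigin (m′ + (k + suc i)))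
                     (trans (cofinite-++ʳ (replicate m′ false) afterGap (k + suc i))
                     (trans (cofinite-++ʳ A (false ∷ afterBlock) (suc i)) (cofinite-∷ false afterBlock i)))

  card-prefix : ∀ m′ t → card (prefix m′ t) ≡ suc (card A + card t)
  card-prefix m′ t = cong suc (begin
    card (replicate m′ false ++ A ++ false ∷ t ++ false ∷ [])
      ≡⟨ card-++ (replicate m′ false) _ ⟩
    card (replicate m′ false) + card (A ++ false ∷ t ++ false ∷ [])
      ≡⟨ cong₂ _+_ (card-replicate-false m′) (card-++ A _) ⟩
    card A + card (t ++ false ∷ [])
      ≡⟨ cong (card A +_) (trans (card-++ t _) (+-identityʳ (card t))) ⟩
    card A + card t ∎)
    where open ≡-Reasoning

  private
    genus-equation : ∀ m′ g a b →
                     g + suc (a + b) ≡ suc (m′ + (k + suc (m′ + 1))) ⇔ g + a + b ≡ suc m′ + suc m′ + k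
    genus-equation m′ g a b = mk⇔ (λ eq → suc-injective (trans (sym (lhs g a b)) (trans eq (rhs m′ k))))
                                  (λ eq → trans (lhs g a b) (trans (cong suc eq) (sym (rhs m′ k))))
      where
      lhs : ∀ g a b → g + suc (a + b) ≡ suc (g + a + b)
      lhs g a b = trans (+-suc g (a + b)) (cong suc (sym (+-assoc g a b)))
      rhs : ∀ m′ k → suc (m′ + (k + suc (m′ + 1))) ≡ suc (suc m′ + suc m′ + k)
      rhs = solve-∀

  candidate-hasGenus⁺ : ∀ {m′ t g} → g + card A + card t ≡ suc m′ + suc m′ + k → HasGenus (candidate m′ t) g
  candidate-hasGenus⁺ {m′} {t} {g} eq = hasGenus-cofinite⁺ (prefix m′ t)
    (trans (cong (g +_) (card-prefix m′ t)) (Equivalence.from (genus-equation m′ g (card A) (card t)) eq))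

  candidate-hasGenus⁻ : ∀ {m′ t g} → HasGenus (candidate m′ t) g → g + card A + card t ≡ suc m′ + suc m′ + k
  candidate-hasGenus⁻ {m′} {t} {g} hasGenus = Equivalence.to (genus-equation m′ g (card A) (card t))
    (trans (cong (g +_) (sym (card-prefix m′ t))) (hasGenus-cofinite⁻ (prefix m′ t) hasGenus))

  private
    2m+k≡m+m+k : ∀ m → 2 * m + k ≡ m + m + k
    2m+k≡m+m+k m = cong (λ z → m + z + k) (+-identityʳ m)

  SumsetClosed : SubsetNat → ℕ → Set
  SumsetClosed S m = ∀ {c} → c < k → inSumset A c ≡ true → S (m + m + c) ≡ true

  module _ {S : SubsetNat} {m′ : ℕ} {t : Vec Bool m′} (S-shape : Shape S m′ t) where

    shape-isMultiplicity : memb A 0 ≡ true → IsMultiplicity S (suc m′)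
    shape-isMultiplicity 0∈A =
      z<s , trans (cong S (sym (+-identityʳ (suc m′)))) (trans (block≡ S-shape z≤n) 0∈A) , below
      where
      below : ∀ i → 0 < i → i < suc m′ → S i ≡ false
      below (suc i) _ (s<s i<m′) = gap∉ S-shape i<m′

    shape-isFrobenius : IsFrobenius S (2 * suc m′ + k)
    shape-isFrobenius = subst (λ x → S x ≡ false) (sym (2m+k≡m+m+k (suc m′))) (frobenius∉ S-shape)
                      , λ x f<x → beyond∈ S-shape (subst (_< x) (2m+k≡m+m+k (suc m′)) f<x)

    shape-hasType : 0 < k → k ≤ m′ → memb A 0 ≡ true → HasType S k A
    shape-hasType 0<k k≤m′ 0∈A =
      suc m′ , 2 * suc m′ + k , shape-isMultiplicity 0∈A , shape-isFrobenius ,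
      m<m+n (2 * suc m′) 0<k , subst (2 * suc m′ + k <_) (3m≡2m+m (suc m′)) (+-monoʳ-< (2 * suc m′) (s≤s k≤m′)) ,
      s≤s k≤m′ , refl , λ i i≤k → block≡ S-shape i≤k
      where
      3m≡2m+m : ∀ m → 2 * m + m ≡ 3 * m
      3m≡2m+m = solve-∀

    private
      A∋ : ∀ {i} → i ≤ k → S (suc m′ + i) ≡ true → memb A i ≡ true
      A∋ i≤k i∈ = trans (sym (block≡ S-shape i≤k)) i∈

      nonzero-≥ : ∀ {x} → S (suc x) ≡ true → m′ ≤ x
      nonzero-≥ {x} x∈ with x <? m′
      ... | yes x<m′ = ⊥-elim (true≢false (trans (sym x∈) (gap∉ S-shape x<m′)))
      ... | no x≮m′ = ≮⇒≥ x≮m′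

      block-sum∈ : In𝒜 k A → SumsetClosed S (suc m′) → ∀ {i j} →
                   S (suc m′ + i) ≡ true → S (suc m′ + j) ≡ true → S (suc m′ + suc m′ + (i + j)) ≡ true
      block-sum∈ (_ , k∉A+A) closed {i} {j} i∈ j∈ with <-cmp (i + j) k
      ... | tri< i+j<k _ _ = closed i+j<k (inSumset-complete A (A∋ (m+n≤o⇒m≤o i (<⇒≤ i+j<k)) i∈)
                                                               (A∋ (m+n≤o⇒n≤o i (<⇒≤ i+j<k)) j∈))
      ... | tri≈ _ i+j≡k _ = ⊥-elim (k∉A+A i j (A∋ (m+n≤o⇒m≤o i (≤-reflexive i+j≡k)) i∈)
                                              (A∋ (m+n≤o⇒n≤o i (≤-reflexive i+j≡k)) j∈) i+j≡k)
      ... | tri> _ _ k<i+j = beyond∈ S-shape (+-monoʳ-< (suc m′ + suc m′) k<i+j)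

    shape-isClosed : In𝒜 k A → SumsetClosed S (suc m′) → IsClosed S
    shape-isClosed _ _ zero y _ y∈ = y∈
    shape-isClosed _ _ (suc x) zero x∈ _ = subst (λ z → S z ≡ true) (sym (+-identityʳ (suc x))) x∈
    shape-isClosed A∈𝒜 closed (suc x) (suc y) x∈ y∈
      with m≤n⇒∃[o]m+o≡n (nonzero-≥ x∈) | m≤n⇒∃[o]m+o≡n (nonzero-≥ y∈)
    ... | i , refl | j , refl = subst (λ z → S z ≡ true) (rearrange (suc m′) i j) (block-sum∈ A∈𝒜 closed x∈ y∈)
      where
      rearrange : ∀ m i j → m + m + (i + j) ≡ m + i + (m + j)
      rearrange = solve-∀

    isClosed⇒sumsetClosed : IsClosed S → SumsetClosed S (suc m′)
    isClosed⇒sumsetClosed S-closed {c} c<k c∈A+A with inSumset-sound A c∈A+A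
    ... | i , i≤c , i∈A , c-i∈A = subst (λ z → S z ≡ true) (rearrange (suc m′) i≤c)
      (S-closed (suc m′ + i) (suc m′ + (c ∸ i)) (trans (block≡ S-shape (≤-trans i≤c (<⇒≤ c<k))) i∈A)
                                                  (trans (block≡ S-shape (≤-trans (m∸n≤m c i) (<⇒≤ c<k))) c-i∈A))
      where
      rearrange : ∀ m {i c} → i ≤ c → m + i + (m + (c ∸ i)) ≡ m + m + c
      rearrange m {i} {c} i≤c = trans (shuffle m i (c ∸ i)) (cong (m + m +_) (m+[n∸m]≡n i≤c))
        where
        shuffle : ∀ m i j → m + i + (m + j) ≡ m + m + (i + j)
        shuffle = solve-∀

    shape-isNumericalSemigroup : In𝒜 k A → SumsetClosed S (suc m′) → IsNumericalSemigroup S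
    shape-isNumericalSemigroup A∈𝒜 closed =
      zero∈ S-shape , shape-isClosed A∈𝒜 closed , suc (suc m′ + suc m′ + k) , λ x f<x → beyond∈ S-shape f<x

  shape-of-type : ∀ {S m′} → S 0 ≡ true → IsMultiplicity S (suc m′) → IsFrobenius S (2 * suc m′ + k) →
                  (∀ i → i ≤ k → S (suc m′ + i) ≡ memb A i) → Shape S m′ (slice S (suc (suc m′ + k)) m′)
  shape-of-type {S} {m′} 0∈S (_ , _ , below-m) (f∉S , beyond-f) on-block = record
    { zero∈ = 0∈S
    ; gap∉ = λ i<m′ → below-m _ z<s (s<s i<m′)
    ; block≡ = on-block _
    ; window≡ = λ i<m′ → sym (memb-slice S (suc (suc m′ + k)) i<m′)
    ; frobenius∉ = subst (λ x → S x ≡ false) (2m+k≡m+m+k (suc m′)) f∉S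
    ; beyond∈ = λ {x} f<x → beyond-f x (subst (_< x) (sym (2m+k≡m+m+k (suc m′))) f<x)
    }

  sumsetIndicator : Subset k
  sumsetIndicator = slice (inSumset A) 0 k

  -- The window positions that closure under addition forces into a semigroup of type (A;k)
  -- with multiplicity 1 + r + k: those of 2m + ((A + A) ∩ [0, k - 1]).
  forced : (r : ℕ) → Vec Bool (r + k)
  forced r = replicate r false ++ sumsetIndicator

  module _ {S : SubsetNat} {r : ℕ} {t : Vec Bool (r + k)} (S-shape : Shape S (r + k) t) where

    private
      window-sumset : ∀ {c} → c < k → S (suc (r + k) + suc (r + k) + c) ≡ memb t (r + c)
      window-sumset {c} c<k = trans (cong S (sym (window-position r k c))) (window≡ S-shape (+-monoʳ-< r c<k))
        where
        window-position : ∀ r k c → suc (suc (r + k) + k + (r + c)) ≡ suc (r + k) + suc (r + k) + c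
        window-position = solve-∀

      forced-sumset : ∀ {c} → c < k → memb (forced r) (r + c) ≡ inSumset A c
      forced-sumset {c} c<k = trans (memb-++ʳ (replicate r false) sumsetIndicator c) (memb-slice (inSumset A) 0 c<k)

    forced⊆⇒sumsetClosed : forced r ⊆ t → SumsetClosed S (suc (r + k))
    forced⊆⇒sumsetClosed forced⊆t {c} c<k c∈A+A =
      trans (window-sumset c<k) (⊆-memb forced⊆t (r + c) (trans (forced-sumset c<k) c∈A+A))

    sumsetClosed⇒forced⊆ : SumsetClosed S (suc (r + k)) → forced r ⊆ t
    sumsetClosed⇒forced⊆ closed = memb-⊆ (forced r) t forced⇒window
      where
      forced⇒window : ∀ i → memb (forced r) i ≡ true → memb t i ≡ true
      forced⇒window i i∈ with i <? r
      ... | yes i<r = ⊥-elim (true≢false (trans (sym i∈)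
                        (trans (memb-++ˡ (replicate r false) sumsetIndicator i<r) (memb-replicate-false r i))))
      ... | no i≮r with m≤n⇒∃[o]m+o≡n (≮⇒≥ i≮r)
      ...   | c , refl = trans (sym (window-sumset c<k)) (closed c<k (trans (sym (forced-sumset c<k)) i∈))
        where
        c<k : c < k
        c<k = memb⇒< sumsetIndicator (trans (sym (memb-++ʳ (replicate r false) sumsetIndicator c)) i∈)

-- Enumeration of the semigroups of genus g and type (A;k)

module Enumeration (g : ℕ) {k : ℕ} (0<k : 0 < k) (A : Subset k) (A∈𝒜 : In𝒜 k A) where

  open OfType A

  frobeniusOf : ℕ → ℕ
  frobeniusOf r = suc (r + k) + suc (r + k) + k

  windows : (r : ℕ) → List (Vec Bool (r + k))
  windows r with g + card A ≤? frobeniusOf r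
  ... | yes _ = supersetsOfSize (forced r) (frobeniusOf r ∸ (g + card A))
  ... | no _ = []

  ∈-windows⁻ : ∀ {r t} → t ∈ windows r → forced r ⊆ t × g + card A + card t ≡ frobeniusOf r
  ∈-windows⁻ {r} {t} t∈ with g + card A ≤? frobeniusOf r
  ... | yes G≤f = let (forced⊆t , card≡) = ∈-supersetsOfSize⁻ (forced r) t∈ in
                  forced⊆t , trans (cong (g + card A +_) card≡) (m+[n∸m]≡n G≤f)

  ∈-windows⁺ : ∀ {r t} → forced r ⊆ t → g + card A + card t ≡ frobeniusOf r → t ∈ windows r
  ∈-windows⁺ {r} {t} forced⊆t eq with g + card A ≤? frobeniusOf r
  ... | yes _ = subst (λ p → t ∈ supersetsOfSize (forced r) p)
                      (sym (trans (cong (_∸ (g + card A)) (sym eq)) (m+n∸m≡n (g + card A) (card t))))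
                      (∈-supersetsOfSize⁺ forced⊆t)
  ... | no G≰f = ⊥-elim (G≰f (subst (g + card A ≤_) eq (m≤m+n (g + card A) (card t))))

  windows-unique : ∀ r → Unique (windows r)
  windows-unique r with g + card A ≤? frobeniusOf r
  ... | yes _ = supersetsOfSize-unique (forced r) _
  ... | no _ = []

  s : ℕ
  s = card sumsetIndicator

  card-forced : ∀ r → card (forced r) ≡ s
  card-forced r = trans (card-++ (replicate r false) sumsetIndicator) (cong (_+ s) (card-replicate-false r))

  length-windows : ∀ r → length (windows r) ≡ (r + k ∸ s) C[ frobeniusOf r - (g + card A + s) ]
  length-windows r with g + card A ≤? frobeniusOf r
  ... | yes G≤f = begin
    length (supersetsOfSize (forced r) (f ∸ G))
      ≡⟨ length-supersetsOfSize (forced r) _ ⟩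
    (r + k ∸ card (forced r)) C[ (f ∸ G) - card (forced r) ]
      ≡⟨ cong (λ c → (r + k ∸ c) C[ (f ∸ G) - c ]) (card-forced r) ⟩
    (r + k ∸ s) C[ (f ∸ G) - s ]
      ≡⟨ C[-]-shift (r + k ∸ s) G _ s ⟨
    (r + k ∸ s) C[ (G + (f ∸ G)) - (G + s) ]
      ≡⟨ cong (λ y → (r + k ∸ s) C[ y - (G + s) ]) (m+[n∸m]≡n G≤f) ⟩
    (r + k ∸ s) C[ f - (G + s) ] ∎
    where
    open ≡-Reasoning
    G = g + card A
    f = frobeniusOf r
  ... | no G≰f = sym (C[-]-< (r + k ∸ s) (<-≤-trans (≰⇒> G≰f) (m≤m+n (g + card A) s)))

  semigroupsWithMultiplicity : ℕ → List SubsetNat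
  semigroupsWithMultiplicity r = map (candidate (r + k)) (windows r)

  semigroups : List SubsetNat
  semigroups = concat (applyUpTo semigroupsWithMultiplicity g)

  private
    P : SubsetNat → Set
    P = NSGgenusType g k A

    0∈A : memb A 0 ≡ true
    0∈A = proj₁ A∈𝒜

  candidate-valid : ∀ {r t} → t ∈ windows r → P (candidate (r + k) t)
  candidate-valid {r} {t} t∈ =
    shape-isNumericalSemigroup shape A∈𝒜 (forced⊆⇒sumsetClosed shape forced⊆t) ,
    candidate-hasGenus⁺ genus ,
    shape-hasType shape 0<k (m≤n+m k r) 0∈A
    where
    shape = candidate-shape (r + k) t
    forced⊆t = proj₁ (∈-windows⁻ t∈)
    genus = proj₂ (∈-windows⁻ t∈)

  semigroups-valid : All P semigroups
  semigroups-valid = All.concat⁺ (All.applyUpTo⁺₂ _ g (λ r → All.map⁺ (All.tabulate candidate-valid)))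

  candidate-injective : ∀ {r r′ t t′} → candidate (r + k) t ≈ₛ candidate (r′ + k) t′ → r ≡ r′
  candidate-injective {r} {r′} {t} {t′} same =
    +-cancelʳ-≡ k r r′ (suc-injective (isMultiplicity-unique same
      (shape-isMultiplicity (candidate-shape (r + k) t) 0∈A)
      (shape-isMultiplicity (candidate-shape (r′ + k) t′) 0∈A)))

  semigroups-distinct : AllPairs Distinct semigroups
  semigroups-distinct = AllPairs.concat⁺ (All.applyUpTo⁺₂ _ g within) (AllPairs.applyUpTo⁺₁ _ g across)
    where
    within : ∀ r → AllPairs Distinct (semigroupsWithMultiplicity r)
    within r = AllPairs.map⁺ (AllPairs.map (λ {t} {t′} t≢t′ same →
      t≢t′ (shape-window-injective (candidate-shape (r + k) t) (candidate-shape (r + k) t′) same))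
      (windows-unique r))
    across : ∀ {i j} → i < j → j < g →
             All (λ S → All (Distinct S) (semigroupsWithMultiplicity j)) (semigroupsWithMultiplicity i)
    across i<j _ = All.map⁺ (All.tabulate λ _ → All.map⁺ (All.tabulate λ _ same → <⇒≢ i<j (candidate-injective same)))

  private
    multiplicity-offset : ∀ {m} → k < m → ∃[ r ] suc (r + k) ≡ m
    multiplicity-offset k<m = let (r , k+r≡m) = m≤n⇒∃[o]m+o≡n k<m in r , trans (cong suc (+-comm r k)) k+r≡m

    -- The window of a semigroup of genus g with multiplicity 1 + r + k has at most r + k elements, so r < g.
    multiplicity-bound : ∀ {r c} → g + card A + c ≡ frobeniusOf r → c ≤ r + k → r < g
    multiplicity-bound {r} {c} eq c≤ with r <? g
    ... | yes r<g = r<g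
    ... | no r≮g =
      ⊥-elim (<-irrefl eq (≤-<-trans (+-mono-≤ (+-mono-≤ (≮⇒≥ r≮g) (card≤length A)) c≤) (bound r k)))
      where
      bound : ∀ r k → r + k + (r + k) < suc (r + k) + suc (r + k) + k
      bound r k = subst (r + k + (r + k) <_) (sym (expand r k)) (m<m+n (r + k + (r + k)) z<s)
        where
        expand : ∀ r k → suc (r + k) + suc (r + k) + k ≡ r + k + (r + k) + suc (suc k)
        expand = solve-∀

  semigroups-complete : ∀ S → P S → Any (S ≈ₛ_) semigroups
  semigroups-complete S (S-nsg , S-genus , m , _ , mult , frob , _ , _ , k<m , refl , on-block)
    with multiplicity-offset k<m
  ... | r , refl = Any.concat⁺ (Any.applyUpTo⁺ semigroupsWithMultiplicity
                     (Any.map⁺ (Any.map (λ { refl → S≈candidate }) (∈-windows⁺ forced⊆t genus)))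
                     (multiplicity-bound genus (card≤length t)))
    where
    t = slice S (suc (suc (r + k) + k)) (r + k)
    shape = shape-of-type (proj₁ S-nsg) mult frob on-block
    S≈candidate = shape-≈ shape (candidate-shape (r + k) t)
    forced⊆t = sumsetClosed⇒forced⊆ shape (isClosed⇒sumsetClosed shape (proj₁ (proj₂ S-nsg)))
    genus = candidate-hasGenus⁻ (hasGenus-resp S≈candidate S-genus)

  length-semigroups : length semigroups ≡ ∑[ r < g ] (r + k ∸ s) C[ frobeniusOf r - (g + card A + s) ]
  length-semigroups = trans (length-concat-applyUpTo g semigroupsWithMultiplicity)
                            (∑-cong g (λ {r} _ → trans (length-map _ (windows r)) (length-windows r)))

  sumsetCount≡s : sumsetCount A ≡ s
  sumsetCount≡s = begin
    countUpTo k (inSumset A)                         ≡⟨ countUpTo≡card-slice k (inSumset A) ⟩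
    card (slice (inSumset A) 0 (suc k))              ≡⟨ cong (λ n → card (slice (inSumset A) 0 n)) (+-comm 1 k) ⟩
    card (slice (inSumset A) 0 (k + 1))              ≡⟨ cong card (slice-+ (inSumset A) 0 k 1) ⟩
    card (sumsetIndicator ++ inSumset A k ∷ [])      ≡⟨ card-++ sumsetIndicator _ ⟩
    s + card (inSumset A k ∷ [])                     ≡⟨ cong (λ b → s + card (b ∷ [])) k∉A+A ⟩
    s + 0                                            ≡⟨ +-identityʳ s ⟩
    s                                                ∎
    where
    open ≡-Reasoning
    k∉A+A : inSumset A k ≡ false
    k∉A+A with inSumset A k in k∈A+A
    ... | false = refl
    ... | true = let (i , i≤k , i∈A , k-i∈A) = inSumset-sound A k∈A+A in
                 ⊥-elim (proj₂ A∈𝒜 i (k ∸ i) i∈A k-i∈A (m+[n∸m]≡n i≤k))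

  private
    u : ℕ
    u = k ∸ s

    s+u≡k : s + u ≡ k
    s+u≡k = m+[n∸m]≡n (card≤length sumsetIndicator)

    free-count : ∀ r → r + k ∸ s ≡ u + r
    free-count r = trans (cong (λ k → r + k ∸ s) (sym s+u≡k))
                         (trans (cong (_∸ s) (shuffle r s u)) (m+n∸m≡n s (u + r)))
      where
      shuffle : ∀ r s u → r + (s + u) ≡ s + (u + r)
      shuffle = solve-∀

  module _ {v : ℕ} (index≡ : s + k + 1 + v ≡ g + card A) where

    private
      term : ℕ → ℕ
      term n = n C[ suc (n + n) - v ]

      window-term : ∀ r → (r + k ∸ s) C[ frobeniusOf r - (g + card A + s) ] ≡ term (u + r)
      window-term r = begin
        (r + k ∸ s) C[ frobeniusOf r - (g + card A + s) ]
          ≡⟨ cong₂ (λ n y → n C[ y - (g + card A + s) ]) (free-count r) frobenius-split ⟩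
        (u + r) C[ (c + suc (u + r + (u + r))) - (g + card A + s) ]
          ≡⟨ cong (λ x → (u + r) C[ (c + suc (u + r + (u + r))) - x ]) genus-split ⟩
        (u + r) C[ (c + suc (u + r + (u + r))) - (c + v) ]
          ≡⟨ C[-]-shift (u + r) c _ v ⟩
        term (u + r) ∎
        where
        open ≡-Reasoning
        c = s + k + 1 + s
        frobenius-split : frobeniusOf r ≡ s + k + 1 + s + suc (u + r + (u + r))
        frobenius-split = subst (λ k → suc (r + k) + suc (r + k) + k ≡ s + k + 1 + s + suc (u + r + (u + r)))
                                s+u≡k (expand r s u)
          where
          expand : ∀ r s u → suc (r + (s + u)) + suc (r + (s + u)) + (s + u)
                             ≡ s + (s + u) + 1 + s + suc (u + r + (u + r))
          expand = solve-∀
        genus-split : g + card A + s ≡ c + v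
        genus-split = trans (cong (_+ s) (sym index≡)) (swap (s + k + 1) s v)
          where
          swap : ∀ a s v → a + v + s ≡ a + s + v
          swap = solve-∀

      ∑-windows≡ : length semigroups ≡ ∑[ r < g ] term (u + r)
      ∑-windows≡ = trans length-semigroups (∑-cong g (λ {r} _ → window-term r))

      v≤g : v ≤ g
      v≤g = +-cancelʳ-≤ k v g (≤-trans (m≤m+n (v + k) (s + 1)) (≤-trans (≤-reflexive (shuffle s k v))
              (subst (_≤ g + k) (sym index≡) (+-monoʳ-≤ g (card≤length A)))))
        where
        shuffle : ∀ s k v → v + k + (s + 1) ≡ s + k + 1 + v
        shuffle = solve-∀

      ∑-term≡fib : ∑[ n < u + g ] term n ≡ fib v
      ∑-term≡fib = ∑-C[-]≡fib v (u + g) (≤-trans v≤g (m≤n+m g u))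

    length-semigroups≤fib : length semigroups ≤ fib v
    length-semigroups≤fib = begin
      length semigroups                       ≡⟨ ∑-windows≡ ⟩
      ∑[ r < g ] term (u + r)                 ≤⟨ m≤n+m _ (∑ u term) ⟩
      ∑ u term + ∑[ r < g ] term (u + r)      ≡⟨ ∑-split u g term ⟨
      ∑[ n < u + g ] term n                   ≡⟨ ∑-term≡fib ⟩
      fib v                                   ∎
      where open ≤-Reasoning

    private
      2u+1≤v : 3 * k + 2 ≤ g + card A + s → u + u + 1 ≤ v
      2u+1≤v large = +-cancelʳ-≤ (s + s + s + u + 1) (u + u + 1) v
        (subst₂ _≤_ (lhs s u) (rhs s u v) (subst (λ k → 3 * k + 2 ≤ s + k + 1 + v + s) (sym s+u≡k)
          (subst (λ G → 3 * k + 2 ≤ G + s) (sym index≡) large)))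
        where
        lhs : ∀ s u → 3 * (s + u) + 2 ≡ u + u + 1 + (s + s + s + u + 1)
        lhs = solve-∀
        rhs : ∀ s u v → s + (s + u) + 1 + v + s ≡ v + (s + s + s + u + 1)
        rhs = solve-∀

      -- For n < u the hypothesis gives 2n + 1 < v.
      low-terms : 3 * k + 2 ≤ g + card A + s → ∑ u term ≡ 0
      low-terms large = ∑-zero u λ {n} n<u → C[-]-< n (begin-strict
        suc (n + n)          <⟨ subst (_≤ u + u) (+-suc (suc n) n) (+-mono-≤ n<u n<u) ⟩
        u + u                ≤⟨ m≤m+n (u + u) 1 ⟩
        u + u + 1            ≤⟨ 2u+1≤v large ⟩
        v                    ∎)
        where open ≤-Reasoning

    length-semigroups≡fib : 3 * k + 2 ≤ g + card A + s → length semigroups ≡ fib v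
    length-semigroups≡fib large = begin
      length semigroups                       ≡⟨ ∑-windows≡ ⟩
      ∑[ r < g ] term (u + r)                 ≡⟨ cong (_+ ∑[ r < g ] term (u + r)) (low-terms large) ⟨
      ∑ u term + ∑[ r < g ] term (u + r)      ≡⟨ ∑-split u g term ⟨
      ∑[ n < u + g ] term n                   ≡⟨ ∑-term≡fib ⟩
      fib v                                   ∎
      where open ≡-Reasoning

  length-semigroups≡0 : g + card A < s + k + 1 → length semigroups ≡ 0
  length-semigroups≡0 index<0 = trans length-semigroups
    (∑-zero g λ {r} _ → C[-]-> (r + k ∸ s) (g + card A + s) (begin-strict
      r + k ∸ s + (g + card A + s)             ≡⟨ cong (_+ (g + card A + s)) (free-count r) ⟩
      u + r + (g + card A + s)                 ≤⟨ +-monoʳ-≤ (u + r) (+-monoˡ-≤ s small) ⟩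
      u + r + (s + k + s)                      <⟨ m<m+n (u + r + (s + k + s)) {suc (suc (r + u))} z<s ⟩
      u + r + (s + k + s) + suc (suc (r + u))  ≡⟨ expand r ⟩
      frobeniusOf r                            ∎))
    where
    open ≤-Reasoning
    small : g + card A ≤ s + k
    small = m<1+n⇒m≤n (subst (g + card A <_) (+-comm (s + k) 1) index<0)
    expand : ∀ r → u + r + (s + k + s) + suc (suc (r + u)) ≡ frobeniusOf r
    expand r = subst (λ k → u + r + (s + k + s) + suc (suc (r + u)) ≡ suc (r + k) + suc (r + k) + k) s+u≡k
                     (expand′ u r s)
      where
      expand′ : ∀ u r s → u + r + (s + (s + u) + s) + suc (suc (r + u))
                          ≡ suc (r + (s + u)) + suc (r + (s + u)) + (s + u)
      expand′ = solve-∀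

  large⇒index≥0 : 3 * k + 2 ≤ g + card A + s → s + k + 1 ≤ g + card A
  large⇒index≥0 large with s + k + 1 ≤? g + card A
  ... | yes index≥0 = index≥0
  ... | no index<0 = ⊥-elim (<⇒≱ (subst (k + k + k <_) (three k) (m<m+n (k + k + k) {2} z<s)) (begin
      3 * k + 2       ≤⟨ large ⟩
      g + card A + s  ≤⟨ +-monoˡ-≤ s (m<1+n⇒m≤n (subst (g + card A <_) (+-comm (s + k) 1) (≰⇒> index<0))) ⟩
      s + k + s       ≤⟨ +-mono-≤ (+-monoˡ-≤ k s≤k) s≤k ⟩
      k + k + k       ∎))
    where
    open ≤-Reasoning
    s≤k = card≤length sumsetIndicator
    three : ∀ k → k + k + k + 2 ≡ 3 * k + 2
    three = solve-∀

  semigroups-atMost : AtMost P (length semigroups)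
  semigroups-atMost L L-valid L-distinct =
    pigeonhole separated L semigroups L-distinct (All.map (semigroups-complete _) L-valid)
    where
    separated : ∀ {S T U} → S ≈ₛ U → T ≈ₛ U → ¬ Distinct S T
    separated S≈U T≈U S≉T = S≉T (λ x → trans (S≈U x) (sym (T≈U x)))

  semigroups-exactly : Exactly P (length semigroups)
  semigroups-exactly = semigroups , semigroups-valid , semigroups-distinct , semigroups-complete , refl

  large-genus : 3 * k ≤ g → 3 * k + 2 ≤ g + card A + sumsetCount A
  large-genus 3k≤g = subst (_≤ g + card A + sumsetCount A) (+-assoc (3 * k) 1 1)
    (+-mono-≤ (+-mono-≤ 3k≤g (memb⇒card>0 A 0∈A))
              (subst (0 <_) (sym sumsetCount≡s) (memb⇒card>0 sumsetIndicator 0∈A+A)))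
    where
    0∈A+A : memb sumsetIndicator 0 ≡ true
    0∈A+A = trans (memb-slice (inSumset A) 0 0<k) (inSumset-complete A {0} {0} 0∈A 0∈A)

-- The Fibonacci index

open import Data.Integer using (ℤ; +_) renaming (_-_ to _-ℤ_; _+_ to _+ℤ_)
import Data.Integer.Tactic.RingSolver as ℤ-Solver

fibIndex≡ : ∀ g s a k {v} → s + k + 1 + v ≡ g + a → (((+ g) -ℤ (+ s)) +ℤ (+ a)) -ℤ (+ k) -ℤ (+ 1) ≡ + v
fibIndex≡ g s a k {v} eq = begin
  (((+ g) -ℤ (+ s)) +ℤ (+ a)) -ℤ (+ k) -ℤ (+ 1)   ≡⟨ regroup (+ g) (+ s) (+ a) (+ k) ⟩
  (+ g +ℤ + a) -ℤ + (s + k + 1)                ≡⟨ cong (λ n → + n -ℤ + (s + k + 1)) eq ⟨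
  (+ (s + k + 1) +ℤ + v) -ℤ + (s + k + 1)      ≡⟨ cancel (+ (s + k + 1)) (+ v) ⟩
  + v                                          ∎
  where
  open ≡-Reasoning
  regroup : ∀ g s a k → (((g -ℤ s) +ℤ a) -ℤ k) -ℤ + 1 ≡ (g +ℤ a) -ℤ ((s +ℤ k) +ℤ + 1)
  regroup = ℤ-Solver.solve-∀
  cancel : ∀ x v → (x +ℤ v) -ℤ x ≡ v
  cancel = ℤ-Solver.solve-∀

module _ (g : ℕ) {k : ℕ} (0<k : 0 < k) (A : Subset k) (A∈𝒜 : In𝒜 k A) where

  open Enumeration g 0<k A A∈𝒜

  private
    index : ℤ
    index = (((+ g) -ℤ (+ sumsetCount A)) +ℤ (+ card A)) -ℤ (+ k) -ℤ (+ 1)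

    index≡ : ∀ {v} → s + k + 1 + v ≡ g + card A → index ≡ + v
    index≡ {v} eq = fibIndex≡ g (sumsetCount A) (card A) k
      (subst (λ c → c + k + 1 + v ≡ g + card A) (sym sumsetCount≡s) eq)

  length-semigroups≤fibℤ : length semigroups ≤ fibℤ index
  length-semigroups≤fibℤ with s + k + 1 ≤? g + card A
  ... | yes index≥0 = let (v , eq) = m≤n⇒∃[o]m+o≡n index≥0 in
                      subst (λ i → length semigroups ≤ fibℤ i) (sym (index≡ eq)) (length-semigroups≤fib eq)
  ... | no index<0 = subst (_≤ fibℤ index) (sym (length-semigroups≡0 (≰⇒> index<0))) z≤n

  length-semigroups≡fibℤ : 3 * k + 2 ≤ g + card A + sumsetCount A → length semigroups ≡ fibℤ index
  length-semigroups≡fibℤ large =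
    let large′ = subst (λ c → 3 * k + 2 ≤ g + card A + c) sumsetCount≡s large
        (v , eq) = m≤n⇒∃[o]m+o≡n (large⇒index≥0 large′)
    in trans (length-semigroups≡fib eq large′) (cong fibℤ (sym (index≡ eq)))

proposition3p5 : (g k : ℕ) → 0 < g → 0 < k → (A : Subset k) → In𝒜 k A →
    AtMost (NSGgenusType g k A)
      (fibℤ ((((+ g) -ℤ (+ sumsetCount A)) +ℤ (+ card A)) -ℤ (+ k) -ℤ (+ 1)))
    × ((3 * k + 2 ≤ g + card A + sumsetCount A) →
        Exactly (NSGgenusType g k A)
          (fibℤ ((((+ g) -ℤ (+ sumsetCount A)) +ℤ (+ card A)) -ℤ (+ k) -ℤ (+ 1))))
    × (3 * k ≤ g → 3 * k + 2 ≤ g + card A + sumsetCount A)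
proposition3p5 g k _ 0<k A A∈𝒜 =
    (λ L L-valid L-distinct →
       ≤-trans (semigroups-atMost L L-valid L-distinct) (length-semigroups≤fibℤ g 0<k A A∈𝒜))
  , (λ large → subst (Exactly _) (length-semigroups≡fibℤ g 0<k A A∈𝒜 large) semigroups-exactly)
  , large-genus
  where open Enumeration g 0<k A A∈𝒜
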